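{- Let $M$ be a term of $\lambda^{Sym}_{Prop}$ that is strongly normalizing with respect to $\to_{\beta\pi}$, and let $x$ be a variable such that $(M\star x)$ (respectively $(x\star M)$) is a term. Then $(M\star x)$ (respectively $(x\star M)$) is strongly normalizing with respect to $\to_{\beta\pi}$.
   Context: The calculus $\lambda^{Sym}_{Prop}$: m-types $A::=\alpha\mid\alpha^\bot\mid A\wedge A\mid A\vee A$; types $C::=A\mid\bot$; negation $(\alpha)^\bot=\alpha^\bot$, $(\alpha^\bot)^\bot=\alpha$, $(A\wedge B)^\bot=A^\bot\vee B^\bot$, $(A\vee B)^\bot=A^\bot\wedge B^\bot$. Typed terms: variables (of m-types); $\langle P_1,P_2\rangle:A_1\wedge A_2$; $\sigma_i(P_i):A_1\vee A_2$; $\lambda xP:A^\bot$ (from $x:A\vdash P:\bot$); $(P_1\star P_2):\bot$ ($P_1:A^\bot$, $P_2:A$). $\to_{\beta\pi}$ is the compatible closure of $(\lambda xP\star Q)\to P[x:=Q]$, $(Q\star\lambda xP)\to P[x:=Q]$, $(\langle P_1,P_2\rangle\star\sigma_i(Q))\to(P_i\star Q)$, $(\sigma_i(Q)\star\langle P_1,P_2\rangle)\to(Q\star P_i)$. -}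

module Defs where

open import Data.Nat using (ℕ)
open import Data.List using (List; []; _∷_)
open import Relation.Binary.PropositionalEquality using (_≡_; refl; cong₂; subst)
open import Induction.WellFounded using (Acc)

infixr 7 _∧'_
infixr 6 _∨'_
data MType : Set where
  atom    : ℕ → MType
  atom⊥   : ℕ → MType
  _∧'_    : MType → MType → MType
  _∨'_    : MType → MType → MType

data Type : Set where
  m   : MType → Type
  bot : Type

neg : MType → MType
neg (atom α)  = atom⊥ α
neg (atom⊥ α) = atom α
neg (A ∧' B)  = neg A ∨' neg B
neg (A ∨' B)  = neg A ∧' neg B

neg-inv : ∀ A → neg (neg A) ≡ A
neg-inv (atom α)  = refl
neg-inv (atom⊥ α) = refl
neg-inv (A ∧' B)  = cong₂ _∧'_ (neg-inv A) (neg-inv B)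
neg-inv (A ∨' B)  = cong₂ _∨'_ (neg-inv A) (neg-inv B)

Ctx : Set
Ctx = List MType

infix 4 _∈_
data _∈_ : MType → Ctx → Set where
  here  : ∀ {A Γ} → A ∈ A ∷ Γ
  there : ∀ {A B Γ} → A ∈ Γ → A ∈ B ∷ Γ

data Tm (Γ : Ctx) : Type → Set where
  var  : ∀ {A} → A ∈ Γ → Tm Γ (m A)
  pair : ∀ {A B} → Tm Γ (m A) → Tm Γ (m B) → Tm Γ (m (A ∧' B))
  σ₁   : ∀ {A B} → Tm Γ (m A) → Tm Γ (m (A ∨' B))
  σ₂   : ∀ {A B} → Tm Γ (m B) → Tm Γ (m (A ∨' B))
  lam  : ∀ {A} → Tm (A ∷ Γ) bot → Tm Γ (m (neg A))
  star : ∀ {A} → Tm Γ (m (neg A)) → Tm Γ (m A) → Tm Γ bot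

Ren : Ctx → Ctx → Set
Ren Γ Δ = ∀ {A} → A ∈ Γ → A ∈ Δ

ext : ∀ {Γ Δ B} → Ren Γ Δ → Ren (B ∷ Γ) (B ∷ Δ)
ext ρ here      = here
ext ρ (there x) = there (ρ x)

rename : ∀ {Γ Δ C} → Ren Γ Δ → Tm Γ C → Tm Δ C
rename ρ (var x)    = var (ρ x)
rename ρ (pair P Q) = pair (rename ρ P) (rename ρ Q)
rename ρ (σ₁ P)     = σ₁ (rename ρ P)
rename ρ (σ₂ P)     = σ₂ (rename ρ P)
rename ρ (lam P)    = lam (rename (ext ρ) P)
rename ρ (star P Q) = star (rename ρ P) (rename ρ Q)

Sub : Ctx → Ctx → Set
Sub Γ Δ = ∀ {A} → A ∈ Γ → Tm Δ (m A)

exts : ∀ {Γ Δ B} → Sub Γ Δ → Sub (B ∷ Γ) (B ∷ Δ)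
exts σ here      = var here
exts σ (there x) = rename there (σ x)

sub : ∀ {Γ Δ C} → Sub Γ Δ → Tm Γ C → Tm Δ C
sub σ (var x)    = σ x
sub σ (pair P Q) = pair (sub σ P) (sub σ Q)
sub σ (σ₁ P)     = σ₁ (sub σ P)
sub σ (σ₂ P)     = σ₂ (sub σ P)
sub σ (lam P)    = lam (sub (exts σ) P)
sub σ (star P Q) = star (sub σ P) (sub σ Q)

single : ∀ {Γ A} → Tm Γ (m A) → Sub (A ∷ Γ) Γ
single Q here      = Q
single Q (there x) = var x

-- P [ x := Q ]  where x is the outermost bound variable of P
_[_] : ∀ {Γ A C} → Tm (A ∷ Γ) C → Tm Γ (m A) → Tm Γ C
P [ Q ] = sub (single Q) P

cast : ∀ {Γ A} → Tm Γ (m (neg (neg A))) → Tm Γ (m A)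
cast {Γ} {A} Q = subst (λ B → Tm Γ (m B)) (neg-inv A) Q

infix 4 _⟶_
data _⟶_ {Γ : Ctx} : ∀ {C} → Tm Γ C → Tm Γ C → Set where
  β₁ : ∀ {A} {P : Tm (A ∷ Γ) bot} {Q : Tm Γ (m A)} →
       star (lam P) Q ⟶ P [ Q ]
  β₂ : ∀ {A} {P : Tm (A ∷ Γ) bot} {Q : Tm Γ (m (neg (neg A)))} →
       star Q (lam P) ⟶ P [ cast Q ]
  π₁ : ∀ {A B} {P₁ : Tm Γ (m (neg A))} {P₂ : Tm Γ (m (neg B))} {Q : Tm Γ (m A)} →
       star {A = A ∨' B} (pair P₁ P₂) (σ₁ Q) ⟶ star P₁ Q
  π₂ : ∀ {A B} {P₁ : Tm Γ (m (neg A))} {P₂ : Tm Γ (m (neg B))} {Q : Tm Γ (m B)} →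
       star {A = A ∨' B} (pair P₁ P₂) (σ₂ Q) ⟶ star P₂ Q
  π₁' : ∀ {A B} {Q : Tm Γ (m (neg A))} {P₁ : Tm Γ (m A)} {P₂ : Tm Γ (m B)} →
       star {A = A ∧' B} (σ₁ Q) (pair P₁ P₂) ⟶ star Q P₁
  π₂' : ∀ {A B} {Q : Tm Γ (m (neg B))} {P₁ : Tm Γ (m A)} {P₂ : Tm Γ (m B)} →
       star {A = A ∧' B} (σ₂ Q) (pair P₁ P₂) ⟶ star Q P₂
  pairˡ : ∀ {A B} {P P' : Tm Γ (m A)} {Q : Tm Γ (m B)} → P ⟶ P' → pair P Q ⟶ pair P' Q
  pairʳ : ∀ {A B} {P : Tm Γ (m A)} {Q Q' : Tm Γ (m B)} → Q ⟶ Q' → pair P Q ⟶ pair P Q'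
  σ₁-cong : ∀ {A B} {P P' : Tm Γ (m A)} → P ⟶ P' → σ₁ {B = B} P ⟶ σ₁ P'
  σ₂-cong : ∀ {A B} {P P' : Tm Γ (m B)} → P ⟶ P' → σ₂ {A = A} P ⟶ σ₂ P'
  lam-cong : ∀ {A} {P P' : Tm (A ∷ Γ) bot} → P ⟶ P' → lam P ⟶ lam P'
  starˡ : ∀ {A} {P P' : Tm Γ (m (neg A))} {Q : Tm Γ (m A)} → P ⟶ P' → star P Q ⟶ star P' Q
  starʳ : ∀ {A} {P : Tm Γ (m (neg A))} {Q Q' : Tm Γ (m A)} → Q ⟶ Q' → star P Q ⟶ star P Q'

SN : ∀ {Γ C} → Tm Γ C → Set
SN {Γ} {C} = Acc (λ N M → M ⟶ N)

module Submission where

-- A term (M ⋆ x) reduces either inside M, or — when M = λ P — at the root to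
-- P[x]. The first kind of step is handled by induction on the strong
-- normalisation of M; for the second we need SN (P[x]) from SN (λ P).
-- Substituting a variable is a renaming, so the key general fact is that
-- renaming preserves strong normalisation. That in turn follows from the
-- observation that renaming REFLECTS reduction: every step out of
-- rename ρ P is the image of a step out of P.

open import Defs
open import Data.Unit using (⊤; tt)
open import Data.Product using (_×_; _,_; Σ-syntax)
open import Data.List using (_∷_)
open import Relation.Binary.PropositionalEquality hiding ([_])
open import Induction.WellFounded using (acc)

rename-square : ∀ {Γ Δ₁ Δ₂ Θ C} {ρ₁ : Ren Δ₁ Θ} {ρ₂ : Ren Γ Δ₁} {ρ₃ : Ren Δ₂ Θ} {ρ₄ : Ren Γ Δ₂} →
  (∀ {A} (x : A ∈ Γ) → ρ₁ (ρ₂ x) ≡ ρ₃ (ρ₄ x)) →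
  (P : Tm Γ C) → rename ρ₁ (rename ρ₂ P) ≡ rename ρ₃ (rename ρ₄ P)
rename-square h (var x)    = cong var (h x)
rename-square h (pair P Q) = cong₂ pair (rename-square h P) (rename-square h Q)
rename-square h (σ₁ P)     = cong σ₁ (rename-square h P)
rename-square h (σ₂ P)     = cong σ₂ (rename-square h P)
rename-square {ρ₁ = ρ₁} {ρ₂} {ρ₃} {ρ₄} h (lam P) = cong lam (rename-square h' P)
  where
  h' : ∀ {A} (x : A ∈ _) → ext ρ₁ (ext ρ₂ x) ≡ ext ρ₃ (ext ρ₄ x)
  h' here      = refl
  h' (there x) = cong there (h x)
rename-square h (star P Q) = cong₂ star (rename-square h P) (rename-square h Q)

rename-sub-square : ∀ {Γ Δ₁ Δ₂ Θ C} {ρ : Ren Δ₁ Θ} {σ : Sub Γ Δ₁} {σ' : Sub Δ₂ Θ} {ρ' : Ren Γ Δ₂} →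
  (∀ {A} (x : A ∈ Γ) → rename ρ (σ x) ≡ σ' (ρ' x)) →
  (P : Tm Γ C) → rename ρ (sub σ P) ≡ sub σ' (rename ρ' P)
rename-sub-square h (var x)    = h x
rename-sub-square h (pair P Q) = cong₂ pair (rename-sub-square h P) (rename-sub-square h Q)
rename-sub-square h (σ₁ P)     = cong σ₁ (rename-sub-square h P)
rename-sub-square h (σ₂ P)     = cong σ₂ (rename-sub-square h P)
rename-sub-square {ρ = ρ} {σ} {σ'} {ρ'} h (lam P) = cong lam (rename-sub-square h' P)
  where
  -- weakening commutes with ρ, then the hypothesis applies under `there`
  h' : ∀ {A} (x : A ∈ _) → rename (ext ρ) (exts σ x) ≡ exts σ' (ext ρ' x)
  h' here      = refl
  h' (there x) = trans (rename-square (λ _ → refl) (σ x)) (cong (rename there) (h x))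
rename-sub-square h (star P Q) = cong₂ star (rename-sub-square h P) (rename-sub-square h Q)

rename-[] : ∀ {Γ Δ A C} (ρ : Ren Γ Δ) (P : Tm (A ∷ Γ) C) (Q : Tm Γ (m A)) →
  rename ρ (P [ Q ]) ≡ rename (ext ρ) P [ rename ρ Q ]
rename-[] ρ P Q = rename-sub-square square P
  where
  square : ∀ {B} (x : B ∈ _) → rename ρ (single Q x) ≡ single (rename ρ Q) (ext ρ x)
  square here      = refl
  square (there x) = refl

sub-var≡rename : ∀ {Γ Δ C} {σ : Sub Γ Δ} {ρ : Ren Γ Δ} →
  (∀ {A} (x : A ∈ Γ) → σ x ≡ var (ρ x)) →
  (P : Tm Γ C) → sub σ P ≡ rename ρ P
sub-var≡rename h (var x)    = h x
sub-var≡rename h (pair P Q) = cong₂ pair (sub-var≡rename h P) (sub-var≡rename h Q)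
sub-var≡rename h (σ₁ P)     = cong σ₁ (sub-var≡rename h P)
sub-var≡rename h (σ₂ P)     = cong σ₂ (sub-var≡rename h P)
sub-var≡rename {σ = σ} {ρ} h (lam P) = cong lam (sub-var≡rename h' P)
  where
  h' : ∀ {A} (x : A ∈ _) → exts σ x ≡ var (ext ρ x)
  h' here      = refl
  h' (there x) = cong (rename there) (h x)
sub-var≡rename h (star P Q) = cong₂ star (sub-var≡rename h P) (sub-var≡rename h Q)

rename-subst : ∀ {Γ Δ A B} (ρ : Ren Γ Δ) (e : A ≡ B) (Q : Tm Γ (m A)) →
  rename ρ (subst (λ C → Tm Γ (m C)) e Q) ≡ subst (λ C → Tm Δ (m C)) e (rename ρ Q)
rename-subst ρ refl Q = refl

rename-cast : ∀ {Γ Δ A} (ρ : Ren Γ Δ) (Q : Tm Γ (m (neg (neg A)))) →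
  rename ρ (cast Q) ≡ cast (rename ρ Q)
rename-cast {A = A} ρ Q = rename-subst ρ (neg-inv A) Q

subst-var : ∀ {Γ A B} (e : A ≡ B) (x : A ∈ Γ) →
  subst (λ C → Tm Γ (m C)) e (var x) ≡ var (subst (_∈ Γ) e x)
subst-var refl x = refl

-- Defining it by
-- matching on Y lets the type index of X be refined along with Y.
RenInv : ∀ {Γ Δ C} → Ren Γ Δ → Tm Γ C → Tm Δ C → Set
RenInv ρ X (lam P)    = Σ[ X' ∈ _ ] (X ≡ lam X' × rename (ext ρ) X' ≡ P)
RenInv ρ X (pair Y Z) = Σ[ X₁ ∈ _ ] Σ[ X₂ ∈ _ ] (X ≡ pair X₁ X₂ × rename ρ X₁ ≡ Y × rename ρ X₂ ≡ Z)
RenInv ρ X (σ₁ Y)     = Σ[ X₁ ∈ _ ] (X ≡ σ₁ X₁ × rename ρ X₁ ≡ Y)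
RenInv ρ X (σ₂ Y)     = Σ[ X₁ ∈ _ ] (X ≡ σ₂ X₁ × rename ρ X₁ ≡ Y)
RenInv ρ X (var y)    = ⊤
RenInv ρ X (star Y Z) = ⊤

-- Every term is a renaming-preimage of its image; transported along an
-- equation `rename ρ X ≡ Y` this inverts renaming one constructor deep.
renInv : ∀ {Γ Δ C} (ρ : Ren Γ Δ) (X : Tm Γ C) → RenInv ρ X (rename ρ X)
renInv ρ (var x)    = tt
renInv ρ (pair X Y) = X , Y , refl , refl , refl
renInv ρ (σ₁ X)     = X , refl , refl
renInv ρ (σ₂ X)     = X , refl , refl
renInv ρ (lam X)    = X , refl , refl
renInv ρ (star X Y) = tt

invert : ∀ {Γ Δ C} {ρ : Ren Γ Δ} (X : Tm Γ C) {Y : Tm Δ C} → rename ρ X ≡ Y → RenInv ρ X Y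
invert {ρ = ρ} X e = subst (RenInv ρ X) e (renInv ρ X)

StepPreimage : ∀ {Γ Δ C} → Ren Γ Δ → Tm Γ C → Tm Δ C → Set
StepPreimage ρ P N = Σ[ P' ∈ _ ] (P ⟶ P' × rename ρ P' ≡ N)

rename-reflects : ∀ {Γ Δ C} (ρ : Ren Γ Δ) (P : Tm Γ C) {N : Tm Δ C} →
  rename ρ P ⟶ N → StepPreimage ρ P N
rename-reflects ρ (var x) ()
rename-reflects ρ (pair P Q) (pairˡ s) with rename-reflects ρ P s
... | P' , s' , refl = pair P' Q , pairˡ s' , refl
rename-reflects ρ (pair P Q) (pairʳ s) with rename-reflects ρ Q s
... | Q' , s' , refl = pair P Q' , pairʳ s' , refl
rename-reflects ρ (σ₁ P) (σ₁-cong s) with rename-reflects ρ P s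
... | P' , s' , refl = σ₁ P' , σ₁-cong s' , refl
rename-reflects ρ (σ₂ P) (σ₂-cong s) with rename-reflects ρ P s
... | P' , s' , refl = σ₂ P' , σ₂-cong s' , refl
rename-reflects ρ (lam P) (lam-cong s) with rename-reflects (ext ρ) P s
... | P' , s' , refl = lam P' , lam-cong s' , refl
rename-reflects ρ (star P Q) s with rename ρ P in e₁ | rename ρ Q in e₂
-- root redexes: invert the renamed redex, then reduce the preimage
rename-reflects ρ (star P Q) β₁ | _ | _ with invert P e₁ | e₂
... | P' , refl , refl | refl = P' [ Q ] , β₁ , rename-[] ρ P' Q
rename-reflects ρ (star P Q) β₂ | _ | _ with e₁ | invert Q e₂
... | refl | Q' , refl , refl = Q' [ cast P ] , β₂ ,
      trans (rename-[] ρ Q' (cast P)) (cong (rename (ext ρ) Q' [_]) (rename-cast ρ P))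
rename-reflects ρ (star P Q) π₁ | _ | _ with invert P e₁ | invert Q e₂
... | P₁ , P₂ , refl , refl , refl | Q₁ , refl , refl = star P₁ Q₁ , π₁ , refl
rename-reflects ρ (star P Q) π₂ | _ | _ with invert P e₁ | invert Q e₂
... | P₁ , P₂ , refl , refl , refl | Q₁ , refl , refl = star P₂ Q₁ , π₂ , refl
rename-reflects ρ (star P Q) π₁' | _ | _ with invert P e₁ | invert Q e₂
... | P₁ , refl , refl | Q₁ , Q₂ , refl , refl , refl = star P₁ Q₁ , π₁' , refl
rename-reflects ρ (star P Q) π₂' | _ | _ with invert P e₁ | invert Q e₂
... | P₁ , refl , refl | Q₁ , Q₂ , refl , refl , refl = star P₁ Q₂ , π₂' , refl
rename-reflects ρ (star P Q) (starˡ s) | _ | _ with e₁ | e₂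
... | refl | refl with rename-reflects ρ P s
...   | P' , s' , refl = star P' Q , starˡ s' , refl
rename-reflects ρ (star P Q) (starʳ s) | _ | _ with e₁ | e₂
... | refl | refl with rename-reflects ρ Q s
...   | Q' , s' , refl = star P Q' , starʳ s' , refl

sn-rename : ∀ {Γ Δ C} (ρ : Ren Γ Δ) (P : Tm Γ C) → SN P → SN (rename ρ P)
sn-rename ρ P (acc sn) = acc λ s → from-preimage (rename-reflects ρ P s)
  where
  from-preimage : ∀ {N} → StepPreimage ρ P N → SN N
  from-preimage (P' , s , refl) = sn-rename ρ P' (sn s)

sn-lam-body : ∀ {Γ A} {P : Tm (A ∷ Γ) bot} → SN (lam P) → SN P
sn-lam-body (acc sn) = acc λ s → sn-lam-body (sn (lam-cong s))

instantiate : ∀ {Γ A} → A ∈ Γ → Ren (A ∷ Γ) Γ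
instantiate x here      = x
instantiate x (there y) = y

sn-var-instance : ∀ {Γ A} (P : Tm (A ∷ Γ) bot) (x : A ∈ Γ) → SN (lam P) → SN (P [ var x ])
sn-var-instance P x sn =
  subst SN (sym (sub-var≡rename single-var P)) (sn-rename (instantiate x) P (sn-lam-body sn))
  where
  single-var : ∀ {B} (y : B ∈ _) → single (var x) y ≡ var (instantiate x y)
  single-var here      = refl
  single-var (there y) = refl

sn-star-varʳ : ∀ {Γ A} (M : Tm Γ (m (neg A))) (x : A ∈ Γ) → SN M → SN (star M (var x))
sn-star-varʳ M x (acc sn) = acc (step M sn)
  where
  step : ∀ M' → (∀ {M''} → M' ⟶ M'' → SN M'') → ∀ {N} → star M' (var x) ⟶ N → SN N
  step (lam P) sn β₁        = sn-var-instance P x (acc sn)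
  step M'      sn (starˡ s) = sn-star-varʳ _ x (sn s)

-- (x ⋆ M) reduces inside M, or by β₂ to P[x] (with x retyped) when M = λ P.
sn-star-varˡ : ∀ {Γ A} (M : Tm Γ (m A)) (x : neg A ∈ Γ) → SN M → SN (star (var x) M)
sn-star-varˡ M x (acc sn) = acc (step M sn)
  where
  step : ∀ M' → (∀ {M''} → M' ⟶ M'' → SN M'') → ∀ {N} → star (var x) M' ⟶ N → SN N
  step (lam {A₀} P) sn β₂ =
    subst SN (cong (P [_]) (sym (subst-var (neg-inv A₀) x)))
      (sn-var-instance P (subst (_∈ _) (neg-inv A₀) x) (acc sn))
  step M' sn (starʳ s) = sn-star-varˡ _ x (sn s)

lemma2p5 : (∀ {Γ A} (M : Tm Γ (m (neg A))) (x : A ∈ Γ) → SN M → SN (star M (var x)))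
           × (∀ {Γ A} (M : Tm Γ (m A)) (x : neg A ∈ Γ) → SN M → SN (star (var x) M))
lemma2p5 = sn-star-varʳ , sn-star-varˡ
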